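{- (1) $R^3(\partial K_2,\partial K_2)=3$. (2) $R^3(\partial K_2,\partial K_s)=s$ for $s\ge 3$. (3) $R^3(\partial K_t,\partial K_s)=t+s-3$ for $s,t\ge 3$. (4) $R^r(\partial K_t,\partial K_s)=\max\{s,t\}$ for $r\ge 4$ and $s,t\ge r$.
   Context: The 2-shadow $\partial_2(\mathcal{H})$ of a hypergraph $\mathcal{H}$ is the graph on $V(\mathcal{H})$ whose edges are the pairs $\{x,y\}$ contained in some hyperedge of $\mathcal{H}$. For a graph $G$, $\partial G$ is the set of $r$-uniform hypergraphs $\mathcal{H}$ whose 2-shadow contains $G$ as a subgraph (up to isomorphism). $K_n$ is the complete graph on $n$ vertices. For collections $\mathcal{F}_1,\mathcal{F}_2$ of $r$-uniform hypergraphs, $R^r(\mathcal{F}_1,\mathcal{F}_2)$ is the least $N$ such that every 2-coloring of the hyperedges of the complete $r$-uniform hypergraph on $N$ vertices contains a subhypergraph of the first color isomorphic to a member of $\mathcal{F}_1$ or one of the second color isomorphic to a member of $\mathcal{F}_2$. (Equivalently, for $\partial K_t$ with color $c$: a set of $t$ vertices every pair of which lies in some hyperedge of color $c$.) -}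

module Defs where

open import Data.Nat using (ℕ; _<_)
open import Data.Bool using (Bool; true; false)
open import Data.Fin using (Fin)
open import Data.Fin.Subset using (Subset; _∈_; ∣_∣)
open import Data.Product using (Σ; ∃; _×_)
open import Data.Sum using (_⊎_)
open import Relation.Binary.PropositionalEquality using (_≡_; _≢_)
open import Relation.Nullary using (¬_)

Edge : ℕ → ℕ → Set
Edge r N = Σ (Subset N) (λ e → ∣ e ∣ ≡ r)

Colouring : ℕ → ℕ → Set
Colouring r N = Edge r N → Bool

-- "A copy of a member of ∂K_t in colour c": a set of t vertices every pair of
-- (distinct) vertices of which lies in some hyperedge of colour c.
ShadowClique : (r N : ℕ) → Colouring r N → Bool → ℕ → Set
ShadowClique r N χ c t =
  Σ (Subset N) λ S → ∣ S ∣ ≡ t ×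
    (∀ x y → x ∈ S → y ∈ S → x ≢ y →
      Σ (Edge r N) λ e → χ e ≡ c × x ∈ Σ.proj₁ e × y ∈ Σ.proj₁ e)

Arrows : (r t s N : ℕ) → Set
Arrows r t s N = (χ : Colouring r N) → ShadowClique r N χ true t ⊎ ShadowClique r N χ false s

RamseyShadowNumber : (r t s N : ℕ) → Set
RamseyShadowNumber r t s N = Arrows r t s N × (∀ M → M < N → ¬ Arrows r t s M)

-- If some colour c covers every pair of the shadow, all N
-- vertices form a c-clique; otherwise each colour misses some pair. A hyperedge
-- through a pair missed by colour 2 has colour 1, which settles t = 2. For
-- r ≥ 4 a pair missed by colour 1 and a pair missed by colour 2 fit into one
-- hyperedge, whose colour covers both. For r = 3 call a vertex c-deficient if
-- some pair through it is missed by colour c; any three vertices lie in a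
-- hyperedge, so no vertex is deficient in both colours. The non-deficient
-- vertices of colour c together with one c-deficient vertex form a c-clique;
-- the two cliques cover all N vertices and share two of them, so their sizes
-- add up to at least N + 2 = t + s − 1.
--
-- A constant colouring has cliques of its own colour only, and
-- with fewer than r vertices there are no hyperedges at all. For r = 3 and
-- t + s − 4 vertices, split the vertex set into A with ∣A∣ ≤ s − 2 and ∁A with
-- ∣∁A∣ ≤ t − 2, and give a triple colour 1 iff it meets A at most once: a
-- clique of colour 1 meets A at most once, and one of colour 2 meets ∁A at
-- most once.
module Submission where

open import Defs
open import Data.Bool using (Bool; true; false; not; T) renaming (_≟_ to _≟ᵇ_)
open import Data.Empty using (⊥-elim)
open import Data.Fin using (Fin)
open import Data.Fin.Properties using (any?) renaming (_≟_ to _≟ᶠ_)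
open import Data.Fin.Subset
open import Data.Fin.Subset.Properties
open import Data.Nat using (ℕ; suc; _+_; _∸_; _≤_; _<_; _⊔_; _≤ᵇ_; z≤n; s≤s; s≤s⁻¹; _≤?_; _≟_)
open import Data.Nat.Properties
open import Data.Product using (Σ; ∃; ∃₂; _×_; _,_; proj₁; proj₂)
open import Data.Unit using (tt)
open import Data.Sum using (_⊎_; inj₁; inj₂; [_,_]′)
open import Data.Vec using (_∷_; []; here; tabulate)
open import Data.Vec.Properties using (lookup∘tabulate; lookup⇒[]=; []=⇒lookup)
open import Relation.Binary.PropositionalEquality
open import Relation.Nullary using (¬_; Dec; yes; no; does)
open import Relation.Nullary.Decidable using (_×-dec_; ¬?; map′; decidable-stable; dec-true)

∈∪ˡ : ∀ {n} {x : Fin n} {p q} → x ∈ p → x ∈ p ∪ q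
∈∪ˡ x∈p = x∈p∪q⁺ (inj₁ x∈p)

∈∪ʳ : ∀ {n} {x : Fin n} {p q} → x ∈ q → x ∈ p ∪ q
∈∪ʳ x∈q = x∈p∪q⁺ (inj₂ x∈q)

x∈p⇒0<∣p∣ : ∀ {n} {x : Fin n} {p} → x ∈ p → 0 < ∣ p ∣
x∈p⇒0<∣p∣ x∈p = ≤-trans (s≤s z≤n) (x∈p⇒∣p-x∣<∣p∣ x∈p)

x≢y⇒2≤∣p∣ : ∀ {n} {x y : Fin n} {p} → x ∈ p → y ∈ p → x ≢ y → 2 ≤ ∣ p ∣
x≢y⇒2≤∣p∣ x∈p y∈p x≢y =
  ≤-trans (s≤s (x∈p⇒0<∣p∣ (x∈p∧x≢y⇒x∈p-y y∈p (λ y≡x → x≢y (sym y≡x))))) (x∈p⇒∣p-x∣<∣p∣ x∈p)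

pairwise-equal⇒∣p∣≤1 : ∀ {n} (p : Subset n) → (∀ {x y} → x ∈ p → y ∈ p → ¬ x ≢ y) → ∣ p ∣ ≤ 1
pairwise-equal⇒∣p∣≤1 {n} p pairwise with nonempty? p
... | no empty rewrite Empty-unique empty | ∣⊥∣≡0 n = z≤n
... | yes (x , x∈p) = ≤-trans (p⊆q⇒∣p∣≤∣q∣ p⊆⁅x⁆) (≤-reflexive (∣⁅x⁆∣≡1 x))
  where
  p⊆⁅x⁆ : p ⊆ ⁅ x ⁆
  p⊆⁅x⁆ {y} y∈p = subst (_∈ ⁅ x ⁆) (decidable-stable (x ≟ᶠ y) (pairwise x∈p y∈p)) (x∈⁅x⁆ x)

∣p∣≡∣p∩q∣+∣p∩∁q∣ : ∀ {n} (p q : Subset n) → ∣ p ∣ ≡ ∣ p ∩ q ∣ + ∣ p ∩ ∁ q ∣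
∣p∣≡∣p∩q∣+∣p∩∁q∣ []            []            = refl
∣p∣≡∣p∩q∣+∣p∩∁q∣ (inside  ∷ p) (inside  ∷ q) = cong suc (∣p∣≡∣p∩q∣+∣p∩∁q∣ p q)
∣p∣≡∣p∩q∣+∣p∩∁q∣ (inside  ∷ p) (outside ∷ q) = trans (cong suc (∣p∣≡∣p∩q∣+∣p∩∁q∣ p q)) (sym (+-suc _ _))
∣p∣≡∣p∩q∣+∣p∩∁q∣ (outside ∷ p) (_       ∷ q) = ∣p∣≡∣p∩q∣+∣p∩∁q∣ p q

∣p∪q∣+∣p∩q∣≡∣p∣+∣q∣ : ∀ {n} (p q : Subset n) → ∣ p ∪ q ∣ + ∣ p ∩ q ∣ ≡ ∣ p ∣ + ∣ q ∣
∣p∪q∣+∣p∩q∣≡∣p∣+∣q∣ []            []            = refl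
∣p∪q∣+∣p∩q∣≡∣p∣+∣q∣ (inside  ∷ p) (inside  ∷ q) =
  cong suc (trans (+-suc _ _) (trans (cong suc (∣p∪q∣+∣p∩q∣≡∣p∣+∣q∣ p q)) (sym (+-suc _ _))))
∣p∪q∣+∣p∩q∣≡∣p∣+∣q∣ (inside  ∷ p) (outside ∷ q) = cong suc (∣p∪q∣+∣p∩q∣≡∣p∣+∣q∣ p q)
∣p∪q∣+∣p∩q∣≡∣p∣+∣q∣ (outside ∷ p) (inside  ∷ q) =
  trans (cong suc (∣p∪q∣+∣p∩q∣≡∣p∣+∣q∣ p q)) (sym (+-suc _ _))
∣p∪q∣+∣p∩q∣≡∣p∣+∣q∣ (outside ∷ p) (outside ∷ q) = ∣p∪q∣+∣p∩q∣≡∣p∣+∣q∣ p q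

∣⁅x⁆∪p∣≤1+∣p∣ : ∀ {n} (x : Fin n) (p : Subset n) → ∣ ⁅ x ⁆ ∪ p ∣ ≤ 1 + ∣ p ∣
∣⁅x⁆∪p∣≤1+∣p∣ x p = begin
  ∣ ⁅ x ⁆ ∪ p ∣                        ≤⟨ m≤m+n _ _ ⟩
  ∣ ⁅ x ⁆ ∪ p ∣ + ∣ ⁅ x ⁆ ∩ p ∣       ≡⟨ ∣p∪q∣+∣p∩q∣≡∣p∣+∣q∣ ⁅ x ⁆ p ⟩
  ∣ ⁅ x ⁆ ∣ + ∣ p ∣                    ≡⟨ cong (_+ ∣ p ∣) (∣⁅x⁆∣≡1 x) ⟩
  1 + ∣ p ∣                            ∎
  where open ≤-Reasoning

∣⁅x⁆∪⁅y⁆∣≤2 : ∀ {n} (x y : Fin n) → ∣ ⁅ x ⁆ ∪ ⁅ y ⁆ ∣ ≤ 2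
∣⁅x⁆∪⁅y⁆∣≤2 x y = ≤-trans (∣⁅x⁆∪p∣≤1+∣p∣ x ⁅ y ⁆) (s≤s (≤-reflexive (∣⁅x⁆∣≡1 y)))

∣⁅x⁆∪⁅y⁆∪⁅z⁆∣≤3 : ∀ {n} (x y z : Fin n) → ∣ ⁅ x ⁆ ∪ ⁅ y ⁆ ∪ ⁅ z ⁆ ∣ ≤ 3
∣⁅x⁆∪⁅y⁆∪⁅z⁆∣≤3 x y z = ≤-trans (∣⁅x⁆∪p∣≤1+∣p∣ x _) (s≤s (∣⁅x⁆∪⁅y⁆∣≤2 y z))

∣⁅w⁆∪⁅x⁆∪⁅y⁆∪⁅z⁆∣≤4 : ∀ {n} (w x y z : Fin n) → ∣ ⁅ w ⁆ ∪ ⁅ x ⁆ ∪ ⁅ y ⁆ ∪ ⁅ z ⁆ ∣ ≤ 4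
∣⁅w⁆∪⁅x⁆∪⁅y⁆∪⁅z⁆∣≤4 w x y z = ≤-trans (∣⁅x⁆∪p∣≤1+∣p∣ w _) (s≤s (∣⁅x⁆∪⁅y⁆∪⁅z⁆∣≤3 x y z))

subset-between : ∀ {n} (p q : Subset n) → p ⊆ q → ∀ k → ∣ p ∣ ≤ k → k ≤ ∣ q ∣ →
                 Σ (Subset n) λ z → p ⊆ z × z ⊆ q × ∣ z ∣ ≡ k
subset-between [] [] _ _ _ z≤n = [] , (λ ()) , (λ ()) , refl
subset-between (inside ∷ p) (outside ∷ q) p⊆q _ _ _ with () ← p⊆q here
subset-between (inside ∷ p) (inside ∷ q) p⊆q (suc k) (s≤s p≤k) (s≤s k≤q)
  with z , p⊆z , z⊆q , ∣z∣≡k ← subset-between p q (drop-∷-⊆ p⊆q) k p≤k k≤q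
  = inside ∷ z , s⊆s p⊆z , s⊆s z⊆q , cong suc ∣z∣≡k
subset-between (outside ∷ p) (outside ∷ q) p⊆q k p≤k k≤q
  with z , p⊆z , z⊆q , ∣z∣≡k ← subset-between p q (drop-∷-⊆ p⊆q) k p≤k k≤q
  = outside ∷ z , s⊆s p⊆z , s⊆s z⊆q , ∣z∣≡k
subset-between (outside ∷ p) (inside ∷ q) p⊆q k p≤k k≤1+q with k ≤? ∣ q ∣
... | yes k≤q with z , p⊆z , z⊆q , ∣z∣≡k ← subset-between p q (drop-∷-⊆ p⊆q) k p≤k k≤q
  = outside ∷ z , s⊆s p⊆z , out⊆ z⊆q , ∣z∣≡k
... | no k≰q = inside ∷ q , out⊆ (drop-∷-⊆ p⊆q) , ⊆-refl , ≤-antisym (≰⇒> k≰q) k≤1+q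

subset-of-size : ∀ {n} (q : Subset n) {k} → k ≤ ∣ q ∣ → Σ (Subset n) λ z → z ⊆ q × ∣ z ∣ ≡ k
subset-of-size {n} q {k} k≤q
  with z , _ , z⊆q , ∣z∣≡k ← subset-between ⊥ q ⊥⊆ k (subst (_≤ k) (sym (∣⊥∣≡0 n)) z≤n) k≤q
  = z , z⊆q , ∣z∣≡k

module _ {n} {P : Fin n → Set} (P? : ∀ x → Dec (P x)) where

  subsetOf : Subset n
  subsetOf = tabulate (λ x → does (P? x))

  ∈subsetOf⁺ : ∀ {x} → P x → x ∈ subsetOf
  ∈subsetOf⁺ {x} px = lookup⇒[]= x subsetOf (trans (lookup∘tabulate _ x) (dec-true (P? x) px))

  ∈subsetOf⁻ : ∀ {x} → x ∈ subsetOf → P x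
  ∈subsetOf⁻ {x} x∈ with P? x | trans (sym (lookup∘tabulate _ x)) ([]=⇒lookup x∈)
  ... | yes px | _  = px
  ... | no  _  | ()

m+n≤1+o+p⇒m≤o⊎n≤p : ∀ {m n o p} → m + n ≤ suc (o + p) → m ≤ o ⊎ n ≤ p
m+n≤1+o+p⇒m≤o⊎n≤p {m} {n} {o} {p} m+n≤ with m ≤? o
... | yes m≤o = inj₁ m≤o
... | no  m≰o = inj₂ (+-cancelˡ-≤ (suc o) n p (≤-trans (+-monoˡ-≤ n (≰⇒> m≰o)) m+n≤))

edge-through : ∀ {r N} {X : Subset N} → ∣ X ∣ ≤ r → r ≤ N → Σ (Edge r N) λ e → X ⊆ proj₁ e
edge-through {r} {N} {X} ∣X∣≤r r≤N
  with Z , X⊆Z , _ , ∣Z∣≡r ← subset-between X ⊤ ⊆⊤ r ∣X∣≤r (subst (r ≤_) (sym (∣⊤∣≡n N)) r≤N)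
  = (Z , ∣Z∣≡r) , X⊆Z

¬Edge : ∀ {r N} → N < r → ¬ Edge r N
¬Edge N<r (e , ∣e∣≡r) = <⇒≱ N<r (subst (_≤ _) ∣e∣≡r (∣p∣≤n e))

module _ {r N : ℕ} (χ : Colouring r N) where

  Covered : Bool → Fin N → Fin N → Set
  Covered c x y = Σ (Edge r N) λ e → χ e ≡ c × x ∈ proj₁ e × y ∈ proj₁ e

  IsClique : Bool → Subset N → Set
  IsClique c S = ∀ x y → x ∈ S → y ∈ S → x ≢ y → Covered c x y

  covered-sym : ∀ {c x y} → Covered c x y → Covered c y x
  covered-sym (e , χe≡c , x∈e , y∈e) = e , χe≡c , y∈e , x∈e

  covered? : ∀ c x y → Dec (Covered c x y)
  covered? c x y = map′ to from (anySubset? coloured-edge?)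
    where
    ColouredEdge : Subset N → Set
    ColouredEdge e = Σ (∣ e ∣ ≡ r) λ ∣e∣≡r → χ (e , ∣e∣≡r) ≡ c × x ∈ e × y ∈ e

    coloured-edge? : ∀ e → Dec (ColouredEdge e)
    coloured-edge? e with ∣ e ∣ ≟ r
    ... | no ∣e∣≢r = no λ (∣e∣≡r , _) → ∣e∣≢r ∣e∣≡r
    ... | yes ∣e∣≡r = map′ (∣e∣≡r ,_) from-any ((χ (e , ∣e∣≡r) ≟ᵇ c) ×-dec (x ∈? e ×-dec y ∈? e))
      where
      from-any : ColouredEdge e → χ (e , ∣e∣≡r) ≡ c × x ∈ e × y ∈ e
      from-any (∣e∣≡r′ , h) rewrite ≡-irrelevant ∣e∣≡r ∣e∣≡r′ = h

    to : ∃ ColouredEdge → Covered c x y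
    to (e , ∣e∣≡r , h) = (e , ∣e∣≡r) , h

    from : Covered c x y → ∃ ColouredEdge
    from ((e , ∣e∣≡r) , h) = e , ∣e∣≡r , h

  clique⇒shadowClique : ∀ {c S k} → IsClique c S → k ≤ ∣ S ∣ → ShadowClique r N χ c k
  clique⇒shadowClique {S = S} clique k≤∣S∣ with Z , Z⊆S , ∣Z∣≡k ← subset-of-size S k≤∣S∣
    = Z , ∣Z∣≡k , λ x y x∈Z y∈Z → clique x y (Z⊆S x∈Z) (Z⊆S y∈Z)

  ⊤-clique⇒shadowClique : ∀ {c k} → IsClique c ⊤ → k ≤ N → ShadowClique r N χ c k
  ⊤-clique⇒shadowClique clique k≤N = clique⇒shadowClique clique (subst (_ ≤_) (sym (∣⊤∣≡n N)) k≤N)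

  ⊤-clique⊎uncovered-pair : ∀ c → IsClique c ⊤ ⊎ ∃₂ λ x y → x ≢ y × ¬ Covered c x y
  ⊤-clique⊎uncovered-pair c with any? (λ x → any? λ y → ¬? (x ≟ᶠ y) ×-dec ¬? (covered? c x y))
  ... | yes (x , y , uncovered) = inj₂ (x , y , uncovered)
  ... | no ∄uncovered = inj₁ λ x y _ _ x≢y →
          decidable-stable (covered? c x y) λ ¬covered → ∄uncovered (x , y , x≢y , ¬covered)

  small-set-covered : ∀ {X : Subset N} → ∣ X ∣ ≤ r → r ≤ N →
                      ∃ λ c → ∀ {x y} → x ∈ X → y ∈ X → Covered c x y
  small-set-covered ∣X∣≤r r≤N with e , X⊆e ← edge-through ∣X∣≤r r≤N
    = χ e , λ x∈X y∈X → e , refl , X⊆e x∈X , X⊆e y∈X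

  ¬ShadowClique-unused : ∀ {c k} → (∀ e → χ e ≢ c) → 2 ≤ k → ¬ ShadowClique r N χ c k
  ¬ShadowClique-unused unused 2≤k (S , ∣S∣≡k , clique) =
    <⇒≱ 2≤k (subst (_≤ 1) ∣S∣≡k (pairwise-equal⇒∣p∣≤1 S no-pair))
    where
    no-pair : ∀ {x y} → x ∈ S → y ∈ S → ¬ x ≢ y
    no-pair x∈S y∈S x≢y with e , χe≡c , _ ← clique _ _ x∈S y∈S x≢y = unused e χe≡c

  ¬ShadowClique-large : ∀ {c k} → N < k → ¬ ShadowClique r N χ c k
  ¬ShadowClique-large N<k (S , ∣S∣≡k , _) = <⇒≱ N<k (subst (_≤ N) ∣S∣≡k (∣p∣≤n S))

arrows-t≡2 : ∀ {r s N} → 2 ≤ r → r ≤ N → s ≤ N → Arrows r 2 s N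
arrows-t≡2 2≤r r≤N s≤N χ with ⊤-clique⊎uncovered-pair χ false
... | inj₁ clique = inj₂ (⊤-clique⇒shadowClique χ clique s≤N)
... | inj₂ (x , y , x≢y , ¬covered)
  with small-set-covered χ {⁅ x ⁆ ∪ ⁅ y ⁆} (≤-trans (∣⁅x⁆∪⁅y⁆∣≤2 x y) 2≤r) r≤N
...   | false , covered = ⊥-elim (¬covered (covered (∈∪ˡ (x∈⁅x⁆ x)) (∈∪ʳ (x∈⁅x⁆ y))))
...   | true  , covered = inj₁ (clique⇒shadowClique χ (λ _ _ u∈ v∈ _ → covered u∈ v∈)
                                   (x≢y⇒2≤∣p∣ (∈∪ˡ (x∈⁅x⁆ x)) (∈∪ʳ (x∈⁅x⁆ y)) x≢y))

arrows-4≤r : ∀ {r t s N} → 4 ≤ r → r ≤ N → t ≤ N → s ≤ N → Arrows r t s N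
arrows-4≤r 4≤r r≤N t≤N s≤N χ with ⊤-clique⊎uncovered-pair χ true | ⊤-clique⊎uncovered-pair χ false
... | inj₁ clique | _ = inj₁ (⊤-clique⇒shadowClique χ clique t≤N)
... | inj₂ _ | inj₁ clique = inj₂ (⊤-clique⇒shadowClique χ clique s≤N)
... | inj₂ (a , b , _ , ¬ab) | inj₂ (c , d , _ , ¬cd)
  with small-set-covered χ {⁅ a ⁆ ∪ ⁅ b ⁆ ∪ ⁅ c ⁆ ∪ ⁅ d ⁆} (≤-trans (∣⁅w⁆∪⁅x⁆∪⁅y⁆∪⁅z⁆∣≤4 a b c d) 4≤r) r≤N
...   | true  , covered = ⊥-elim (¬ab (covered (∈∪ˡ (x∈⁅x⁆ a)) (∈∪ʳ (∈∪ˡ (x∈⁅x⁆ b)))))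
...   | false , covered = ⊥-elim (¬cd (covered (∈∪ʳ (∈∪ʳ (∈∪ˡ (x∈⁅x⁆ c)))) (∈∪ʳ (∈∪ʳ (∈∪ʳ (x∈⁅x⁆ d))))))

module Deficiency {N : ℕ} (χ : Colouring 3 N) (3≤N : 3 ≤ N) where

  Deficient : Bool → Fin N → Set
  Deficient c x = ∃ λ y → ¬ Covered χ c x y

  deficient? : ∀ c x → Dec (Deficient c x)
  deficient? c x = any? λ y → ¬? (covered? χ c x y)

  D : Bool → Subset N
  D c = subsetOf (deficient? c)

  ∉D⇒covered : ∀ {c x} → x ∉ D c → ∀ y → Covered χ c x y
  ∉D⇒covered {c} {x} x∉D y =
    decidable-stable (covered? χ c x y) λ ¬covered → x∉D (∈subsetOf⁺ (deficient? c) (y , ¬covered))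

  ¬deficient-both : ∀ {x} → ¬ (Deficient true x × Deficient false x)
  ¬deficient-both {x} ((y , ¬xy) , (z , ¬xz))
    with small-set-covered χ {⁅ x ⁆ ∪ ⁅ y ⁆ ∪ ⁅ z ⁆} (∣⁅x⁆∪⁅y⁆∪⁅z⁆∣≤3 x y z) 3≤N
  ... | true  , covered = ¬xy (covered (∈∪ˡ (x∈⁅x⁆ x)) (∈∪ʳ (∈∪ˡ (x∈⁅x⁆ y))))
  ... | false , covered = ¬xz (covered (∈∪ˡ (x∈⁅x⁆ x)) (∈∪ʳ (∈∪ʳ (x∈⁅x⁆ z))))

  ∁D∪⁅a⁆-clique : ∀ c a → IsClique χ c (∁ (D c) ∪ ⁅ a ⁆)
  ∁D∪⁅a⁆-clique c a x y x∈ y∈ x≢y with x∈p∪q⁻ (∁ (D c)) _ x∈ | x∈p∪q⁻ (∁ (D c)) _ y∈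
  ... | inj₁ x∈∁D | _         = ∉D⇒covered (x∈∁p⇒x∉p x∈∁D) y
  ... | inj₂ _    | inj₁ y∈∁D = covered-sym χ (∉D⇒covered (x∈∁p⇒x∉p y∈∁D) x)
  ... | inj₂ x≡a  | inj₂ y≡a  = ⊥-elim (x≢y (trans (x∈⁅y⁆⇒x≡y a x≡a) (sym (x∈⁅y⁆⇒x≡y a y≡a))))

  deficient⇒∈∁D-not : ∀ {c x} → Deficient c x → x ∈ ∁ (D (not c))
  deficient⇒∈∁D-not {true}  def =
    x∉p⇒x∈∁p λ x∈D → ¬deficient-both (def , ∈subsetOf⁻ (deficient? false) x∈D)
  deficient⇒∈∁D-not {false} def =
    x∉p⇒x∈∁p λ x∈D → ¬deficient-both (∈subsetOf⁻ (deficient? true) x∈D , def)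

  cliques-large : ∀ {a b} → Deficient true a → Deficient false b →
                  2 + N ≤ ∣ ∁ (D true) ∪ ⁅ a ⁆ ∣ + ∣ ∁ (D false) ∪ ⁅ b ⁆ ∣
  cliques-large {a} {b} a-deficient b-deficient = begin
    2 + N                                 ≤⟨ +-mono-≤ (x≢y⇒2≤∣p∣ a∈both b∈both a≢b) N≤∣∪∣ ⟩
    ∣ Sᵗ ∩ Sᶠ ∣ + ∣ Sᵗ ∪ Sᶠ ∣             ≡⟨ +-comm ∣ Sᵗ ∩ Sᶠ ∣ ∣ Sᵗ ∪ Sᶠ ∣ ⟩
    ∣ Sᵗ ∪ Sᶠ ∣ + ∣ Sᵗ ∩ Sᶠ ∣             ≡⟨ ∣p∪q∣+∣p∩q∣≡∣p∣+∣q∣ Sᵗ Sᶠ ⟩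
    ∣ Sᵗ ∣ + ∣ Sᶠ ∣                        ∎
    where
    open ≤-Reasoning
    Sᵗ Sᶠ : Subset N
    Sᵗ = ∁ (D true) ∪ ⁅ a ⁆
    Sᶠ = ∁ (D false) ∪ ⁅ b ⁆

    a∈both : a ∈ Sᵗ ∩ Sᶠ
    a∈both = x∈p∩q⁺ (∈∪ʳ (x∈⁅x⁆ a) , ∈∪ˡ (deficient⇒∈∁D-not a-deficient))

    b∈both : b ∈ Sᵗ ∩ Sᶠ
    b∈both = x∈p∩q⁺ (∈∪ˡ (deficient⇒∈∁D-not b-deficient) , ∈∪ʳ (x∈⁅x⁆ b))

    a≢b : a ≢ b
    a≢b refl = ¬deficient-both (a-deficient , b-deficient)

    ⊤⊆∪ : ⊤ ⊆ Sᵗ ∪ Sᶠ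
    ⊤⊆∪ {x} _ with x ∈? D true
    ... | yes x∈D = ∈∪ʳ (∈∪ˡ (deficient⇒∈∁D-not (∈subsetOf⁻ (deficient? true) x∈D)))
    ... | no  x∉D = ∈∪ˡ (∈∪ˡ (x∉p⇒x∈∁p x∉D))

    N≤∣∪∣ : N ≤ ∣ Sᵗ ∪ Sᶠ ∣
    N≤∣∪∣ = subst (_≤ ∣ Sᵗ ∪ Sᶠ ∣) (∣⊤∣≡n N) (p⊆q⇒∣p∣≤∣q∣ ⊤⊆∪)

arrows-r≡3 : ∀ {t s N} → 3 ≤ N → t ≤ N → s ≤ N → t + s ≤ 3 + N → Arrows 3 t s N
arrows-r≡3 3≤N t≤N s≤N t+s≤3+N χ with ⊤-clique⊎uncovered-pair χ true | ⊤-clique⊎uncovered-pair χ false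
... | inj₁ clique | _ = inj₁ (⊤-clique⇒shadowClique χ clique t≤N)
... | inj₂ _ | inj₁ clique = inj₂ (⊤-clique⇒shadowClique χ clique s≤N)
... | inj₂ (a , b , _ , ¬ab) | inj₂ (c , d , _ , ¬cd)
  with m+n≤1+o+p⇒m≤o⊎n≤p (≤-trans t+s≤3+N (s≤s (Deficiency.cliques-large χ 3≤N (b , ¬ab) (d , ¬cd))))
...   | inj₁ t≤ = inj₁ (clique⇒shadowClique χ (Deficiency.∁D∪⁅a⁆-clique χ 3≤N true a) t≤)
...   | inj₂ s≤ = inj₂ (clique⇒shadowClique χ (Deficiency.∁D∪⁅a⁆-clique χ 3≤N false c) s≤)

module SplitColouring {M : ℕ} (A : Subset M) where

  χ : Colouring 3 M
  χ (e , _) = ∣ e ∩ A ∣ ≤ᵇ 1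

  χ≡true⇒∣e∩A∣≤1 : ∀ e → χ e ≡ true → ∣ proj₁ e ∩ A ∣ ≤ 1
  χ≡true⇒∣e∩A∣≤1 e χe≡true = ≤ᵇ⇒≤ _ 1 (subst T (sym χe≡true) tt)

  χ≡false⇒2≤∣e∩A∣ : ∀ e → χ e ≡ false → 2 ≤ ∣ proj₁ e ∩ A ∣
  χ≡false⇒2≤∣e∩A∣ e χe≡false = ≰⇒> λ ∣e∩A∣≤1 → subst T χe≡false (≤⇒≤ᵇ ∣e∩A∣≤1)

  true-clique-bound : ∀ {S} → IsClique χ true S → ∣ S ∣ ≤ 1 + ∣ ∁ A ∣
  true-clique-bound {S} clique = begin
    ∣ S ∣                     ≡⟨ ∣p∣≡∣p∩q∣+∣p∩∁q∣ S A ⟩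
    ∣ S ∩ A ∣ + ∣ S ∩ ∁ A ∣  ≤⟨ +-mono-≤ (pairwise-equal⇒∣p∣≤1 (S ∩ A) no-pair) (∣p∩q∣≤∣q∣ S (∁ A)) ⟩
    1 + ∣ ∁ A ∣               ∎
    where
    open ≤-Reasoning
    no-pair : ∀ {x y} → x ∈ S ∩ A → y ∈ S ∩ A → ¬ x ≢ y
    no-pair x∈ y∈ x≢y with e , χe≡true , x∈e , y∈e ← clique _ _ (p∩q⊆p S A x∈) (p∩q⊆p S A y∈) x≢y
      = <⇒≱ (x≢y⇒2≤∣p∣ (x∈p∩q⁺ (x∈e , p∩q⊆q S A x∈)) (x∈p∩q⁺ (y∈e , p∩q⊆q S A y∈)) x≢y)
            (χ≡true⇒∣e∩A∣≤1 e χe≡true)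

  false-clique-bound : ∀ {S} → IsClique χ false S → ∣ S ∣ ≤ ∣ A ∣ + 1
  false-clique-bound {S} clique = begin
    ∣ S ∣                     ≡⟨ ∣p∣≡∣p∩q∣+∣p∩∁q∣ S A ⟩
    ∣ S ∩ A ∣ + ∣ S ∩ ∁ A ∣  ≤⟨ +-mono-≤ (∣p∩q∣≤∣q∣ S A) (pairwise-equal⇒∣p∣≤1 (S ∩ ∁ A) no-pair) ⟩
    ∣ A ∣ + 1                 ∎
    where
    open ≤-Reasoning
    no-pair : ∀ {x y} → x ∈ S ∩ ∁ A → y ∈ S ∩ ∁ A → ¬ x ≢ y
    no-pair x∈ y∈ x≢y
      with (e , ∣e∣≡3) , χe≡false , x∈e , y∈e ← clique _ _ (p∩q⊆p S _ x∈) (p∩q⊆p S _ y∈) x≢y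
      = 1+n≰n (begin
          4                         ≤⟨ +-mono-≤ (χ≡false⇒2≤∣e∩A∣ (e , ∣e∣≡3) χe≡false) 2≤∣e∩∁A∣ ⟩
          ∣ e ∩ A ∣ + ∣ e ∩ ∁ A ∣  ≡⟨ sym (∣p∣≡∣p∩q∣+∣p∩∁q∣ e A) ⟩
          ∣ e ∣                     ≡⟨ ∣e∣≡3 ⟩
          3                         ∎)
      where
      2≤∣e∩∁A∣ : 2 ≤ ∣ e ∩ ∁ A ∣
      2≤∣e∩∁A∣ = x≢y⇒2≤∣p∣ (x∈p∩q⁺ (x∈e , p∩q⊆q S _ x∈)) (x∈p∩q⁺ (y∈e , p∩q⊆q S _ y∈)) x≢y

¬Arrows-split : ∀ {M t s} → M ≤ t + s → ¬ Arrows 3 (2 + t) (2 + s) M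
¬Arrows-split {M} {t} {s} M≤t+s arrows
  with A , _ , ∣A∣≡M∸t ← subset-of-size ⊤ (subst (M ∸ t ≤_) (sym (∣⊤∣≡n M)) (m∸n≤m M t))
  with arrows (SplitColouring.χ A)
... | inj₁ (S , ∣S∣≡2+t , clique) = 1+n≰n (begin
  2 + t        ≡⟨ sym ∣S∣≡2+t ⟩
  ∣ S ∣        ≤⟨ SplitColouring.true-clique-bound A clique ⟩
  1 + ∣ ∁ A ∣  ≤⟨ s≤s ∣∁A∣≤t ⟩
  1 + t        ∎)
  where
  open ≤-Reasoning
  ∣∁A∣≤t : ∣ ∁ A ∣ ≤ t
  ∣∁A∣≤t rewrite ∣∁p∣≡n∸∣p∣ A | ∣A∣≡M∸t =
    m≤n+o⇒m∸n≤o M (M ∸ t) (subst (M ≤_) (+-comm t (M ∸ t)) (m≤n+m∸n M t))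
... | inj₂ (S , ∣S∣≡2+s , clique) = 1+n≰n (begin
  2 + s        ≡⟨ sym ∣S∣≡2+s ⟩
  ∣ S ∣        ≤⟨ SplitColouring.false-clique-bound A clique ⟩
  ∣ A ∣ + 1    ≤⟨ +-monoˡ-≤ 1 (subst (_≤ s) (sym ∣A∣≡M∸t) (m≤n+o⇒m∸n≤o M t M≤t+s)) ⟩
  s + 1        ≡⟨ +-comm s 1 ⟩
  1 + s        ∎)
  where open ≤-Reasoning

¬Arrows-below-t : ∀ {r t s M} → 2 ≤ s → M < t → ¬ Arrows r t s M
¬Arrows-below-t 2≤s M<t arrows with arrows (λ _ → true)
... | inj₁ clique = ¬ShadowClique-large _ M<t clique
... | inj₂ clique = ¬ShadowClique-unused _ (λ _ ()) 2≤s clique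

¬Arrows-below-s : ∀ {r t s M} → 2 ≤ t → M < s → ¬ Arrows r t s M
¬Arrows-below-s 2≤t M<s arrows with arrows (λ _ → false)
... | inj₁ clique = ¬ShadowClique-unused _ (λ _ ()) 2≤t clique
... | inj₂ clique = ¬ShadowClique-large _ M<s clique

¬Arrows-below-r : ∀ {r t s M} → 2 ≤ t → 2 ≤ s → M < r → ¬ Arrows r t s M
¬Arrows-below-r 2≤t 2≤s M<r arrows with arrows (λ _ → true)
... | inj₁ clique = ¬ShadowClique-unused _ (λ e _ → ¬Edge M<r e) 2≤t clique
... | inj₂ clique = ¬ShadowClique-unused _ (λ e _ → ¬Edge M<r e) 2≤s clique

m<n⊔o⇒m<n⊎m<o : ∀ {m n o} → m < n ⊔ o → m < n ⊎ m < o
m<n⊔o⇒m<n⊎m<o {m} {n} {o} m<n⊔o with ⊔-sel n o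
... | inj₁ n⊔o≡n = inj₁ (subst (m <_) n⊔o≡n m<n⊔o)
... | inj₂ n⊔o≡o = inj₂ (subst (m <_) n⊔o≡o m<n⊔o)

ramsey-r≡3 : ∀ t s → 3 ≤ t → 3 ≤ s → RamseyShadowNumber 3 t s (t + s ∸ 3)
ramsey-r≡3 (suc (suc (suc t))) (suc (suc (suc s))) (s≤s (s≤s (s≤s _))) 3≤s@(s≤s (s≤s (s≤s _))) =
    arrows-r≡3 (≤-trans 3≤s s≤N) t≤N s≤N ≤-refl
  , λ M M<N → ¬Arrows-split (s≤s⁻¹ (subst (suc M ≤_) (trans (+-suc t _) (cong suc (+-suc t _))) M<N))
  where
  s≤N : 3 + s ≤ t + (3 + s)
  s≤N = m≤n+m _ t
  t≤N : 3 + t ≤ t + (3 + s)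
  t≤N = subst (_≤ t + (3 + s)) (+-comm t 3) (+-monoʳ-≤ t 3≤s)

ramsey-4≤r : ∀ r t s → 4 ≤ r → r ≤ t → r ≤ s → RamseyShadowNumber r t s (t ⊔ s)
ramsey-4≤r r t s 4≤r r≤t r≤s =
    arrows-4≤r 4≤r (≤-trans r≤t (m≤m⊔n t s)) (m≤m⊔n t s) (m≤n⊔m t s)
  , λ M M<t⊔s → [ ¬Arrows-below-t (≤-trans 2≤r r≤s) , ¬Arrows-below-s (≤-trans 2≤r r≤t) ]′
                  (m<n⊔o⇒m<n⊎m<o M<t⊔s)
  where
  2≤r : 2 ≤ r
  2≤r = ≤-trans (n≤1+n 2) (≤-trans (n≤1+n 3) 4≤r)

theorem1p16 : RamseyShadowNumber 3 2 2 3
    × (∀ s → 3 ≤ s → RamseyShadowNumber 3 2 s s)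
    × (∀ t s → 3 ≤ t → 3 ≤ s → RamseyShadowNumber 3 t s (t + s ∸ 3))
    × (∀ r t s → 4 ≤ r → r ≤ t → r ≤ s → RamseyShadowNumber r t s (t ⊔ s))
theorem1p16 =
    (arrows-t≡2 (n≤1+n 2) ≤-refl (n≤1+n 2) , λ M → ¬Arrows-below-r ≤-refl ≤-refl)
  , (λ s 3≤s → arrows-t≡2 (n≤1+n 2) 3≤s ≤-refl , λ M → ¬Arrows-below-s ≤-refl)
  , ramsey-r≡3
  , ramsey-4≤r
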